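{- Let $G$ be a finite graph containing at least one cycle which has a difference-1 colouring, and let $P=v_1v_2\dots v_k$ be a limb of $\mathrm{Sk}(G)$ whose endpoints $v_1$ and $v_k$ are each twig-type or triple-type. Then $P$ has odd length if $v_1$ and $v_k$ are of the same type, and even length if they are of opposite type.
   Context: A colouring of a graph is a map from its edges to $\{\text{blue},\text{red}\}$; it is a difference-1 colouring if at every vertex the number of incident blue edges minus the number of incident red edges equals $1$. A leaf is a vertex of degree $1$. A twig is a vertex $b$ of degree $3$ (its base) with two leaves adjacent to $b$. A leaf-twig configuration at $v$ consists of four vertices distinct from $v$: a leaf $\ell$ and a twig with base $b$, with $\ell$ and $b$ both adjacent to $v$; removing it deletes these four vertices and their four incident edges. The reduced form $H$ of $G$ is obtained by repeatedly removing leaf-twig configurations until none remain. The skeleton $\mathrm{Sk}(G)$ is the subgraph obtained by repeatedly deleting leaves (and incident edges) until none remain. A vertex of degree $2$ in $\mathrm{Sk}(G)$ is leaf-type if it has degree $3$ in $H$ and is adjacent in $H$ to a leaf; twig-type if it has degree $3$ in $H$ and is adjacent in $H$ to the base of a twig; triple-type if it has degree $5$ in $H$ and is adjacent in $H$ to three leaves. Twig-type and triple-type are opposite types. If $\mathrm{Sk}(G)$ has a vertex that is not leaf-type, a limb is a subgraph of $\mathrm{Sk}(G)$ whose edges form a trail whose only non-leaf-type vertices are its (not necessarily distinct) endpoints. The length of $P$ is its number of edges, $k-1$. -}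

module Defs where

open import Data.Nat using (ℕ; zero; suc; _+_; _≤_; _%_)
open import Data.Fin using (Fin; zero; suc; inject₁; fromℕ; _≟_)
open import Data.Bool using (Bool; true; false; _∧_; not; if_then_else_)
open import Data.Product using (Σ; _×_; _,_)
open import Data.Sum using (_⊎_)
open import Relation.Nullary using (¬_; ⌊_⌋)
open import Relation.Binary.PropositionalEquality using (_≡_; _≢_)
open import Relation.Binary.Construct.Closure.ReflexiveTransitive using (Star)

record Graph (n : ℕ) : Set where
  field
    adj     : Fin n → Fin n → Bool
    adj-sym : ∀ u v → adj u v ≡ adj v u
    adj-irr : ∀ v → adj v v ≡ false
open Graph public

count : ∀ {n} → (Fin n → Bool) → ℕ
count {zero}  p = 0
count {suc n} p = (if p zero then 1 else 0) + count (λ i → p (suc i))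

_==_ : ∀ {n} → Fin n → Fin n → Bool
x == y = ⌊ x ≟ y ⌋

-- Induced subgraphs are given by their vertex sets  S : Fin n → Bool.
VSet : ℕ → Set
VSet n = Fin n → Bool

full : ∀ {n} → VSet n
full _ = true

module _ {n : ℕ} (G : Graph n) where

  deg : VSet n → Fin n → ℕ
  deg S v = count (λ u → S u ∧ adj G v u)

  -- Colourings (true = blue, false = red); a colouring of the edges
  -- is a symmetric function on pairs (its values on non-edges are
  -- irrelevant).
  record Colouring : Set where
    field
      col     : Fin n → Fin n → Bool
      col-sym : ∀ u v → col u v ≡ col v u
  open Colouring public

  blueDeg redDeg : Colouring → Fin n → ℕ
  blueDeg c v = count (λ u → adj G v u ∧ col c v u)
  redDeg  c v = count (λ u → adj G v u ∧ not (col c v u))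

  IsDiff1 : Colouring → Set
  IsDiff1 c = ∀ v → blueDeg c v ≡ redDeg c v + 1

  HasDiff1Colouring : Set
  HasDiff1Colouring = Σ Colouring IsDiff1

  HasCycle : Set
  HasCycle = Σ ℕ λ j → Σ (Fin (suc (suc (suc j))) → Fin n) λ c →
      (∀ i i' → c i ≡ c i' → i ≡ i')
    × (∀ (i : Fin (suc (suc j))) → adj G (c (inject₁ i)) (c (suc i)) ≡ true)
    × adj G (c (fromℕ (suc (suc j)))) (c zero) ≡ true

  Leaf : VSet n → Fin n → Set
  Leaf S x = S x ≡ true × deg S x ≡ 1

  TwigBase : VSet n → Fin n → Set
  TwigBase S b = S b ≡ true × deg S b ≡ 3 ×
    Σ (Fin n) λ l₁ → Σ (Fin n) λ l₂ → l₁ ≢ l₂ ×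
      adj G b l₁ ≡ true × adj G b l₂ ≡ true × Leaf S l₁ × Leaf S l₂

  LTConfig : VSet n → (v ℓ b l₁ l₂ : Fin n) → Set
  LTConfig S v ℓ b l₁ l₂ =
      S v ≡ true
    × (v ≢ ℓ) × (v ≢ b) × (v ≢ l₁) × (v ≢ l₂)
    × (ℓ ≢ b) × (ℓ ≢ l₁) × (ℓ ≢ l₂) × (b ≢ l₁) × (b ≢ l₂) × (l₁ ≢ l₂)
    × Leaf S ℓ × adj G v ℓ ≡ true × adj G v b ≡ true
    × S b ≡ true × deg S b ≡ 3
    × adj G b l₁ ≡ true × adj G b l₂ ≡ true × Leaf S l₁ × Leaf S l₂

  HasLTConfig : VSet n → Set
  HasLTConfig S = Σ (Fin n) λ v → Σ (Fin n) λ ℓ → Σ (Fin n) λ b →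
    Σ (Fin n) λ l₁ → Σ (Fin n) λ l₂ → LTConfig S v ℓ b l₁ l₂

  LTStep : VSet n → VSet n → Set
  LTStep S S' = Σ (Fin n) λ v → Σ (Fin n) λ ℓ → Σ (Fin n) λ b →
    Σ (Fin n) λ l₁ → Σ (Fin n) λ l₂ → LTConfig S v ℓ b l₁ l₂ ×
    (∀ x → S' x ≡ (S x ∧ not (x == ℓ) ∧ not (x == b) ∧ not (x == l₁) ∧ not (x == l₂)))

  IsReducedForm : VSet n → Set
  IsReducedForm H = Star LTStep full H × ¬ HasLTConfig H

  LeafStep : VSet n → VSet n → Set
  LeafStep S S' = Σ (Fin n) λ x → Leaf S x × (∀ y → S' y ≡ (S y ∧ not (y == x)))

  IsSkeleton : VSet n → Set
  IsSkeleton K = Star LeafStep full K × (∀ x → ¬ Leaf K x)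

  module _ (K H : VSet n) where

    Deg2InSk : Fin n → Set
    Deg2InSk x = K x ≡ true × deg K x ≡ 2

    LeafType : Fin n → Set
    LeafType x = Deg2InSk x × H x ≡ true × deg H x ≡ 3 ×
      Σ (Fin n) λ y → adj G x y ≡ true × Leaf H y

    TwigType : Fin n → Set
    TwigType x = Deg2InSk x × H x ≡ true × deg H x ≡ 3 ×
      Σ (Fin n) λ b → adj G x b ≡ true × TwigBase H b

    TripleType : Fin n → Set
    TripleType x = Deg2InSk x × H x ≡ true × deg H x ≡ 5 ×
      Σ (Fin n) λ y₁ → Σ (Fin n) λ y₂ → Σ (Fin n) λ y₃ →
        y₁ ≢ y₂ × y₁ ≢ y₃ × y₂ ≢ y₃ ×
        adj G x y₁ ≡ true × adj G x y₂ ≡ true × adj G x y₃ ≡ true ×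
        Leaf H y₁ × Leaf H y₂ × Leaf H y₃

    -- A limb with m ≥ 1 edges, given by its vertex sequence
    -- p zero, ..., p (fromℕ m)  (so k = m + 1 and the length is m):
    -- consecutive vertices adjacent in Sk(G), the m edges pairwise
    -- distinct (a trail), internal vertices leaf-type, endpoints not.
    IsLimb : (m : ℕ) → (Fin (suc m) → Fin n) → Set
    IsLimb m p =
        1 ≤ m
      × (∀ (i : Fin m) → K (p (inject₁ i)) ≡ true × K (p (suc i)) ≡ true
                         × adj G (p (inject₁ i)) (p (suc i)) ≡ true)
      × (∀ (i j : Fin m) → i ≢ j →
            ¬ (p (inject₁ i) ≡ p (inject₁ j) × p (suc i) ≡ p (suc j))
          × ¬ (p (inject₁ i) ≡ p (suc j) × p (suc i) ≡ p (inject₁ j)))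
      × (∀ (i : Fin (suc m)) → i ≢ zero → i ≢ fromℕ m → LeafType (p i))
      × ¬ LeafType (p zero) × ¬ LeafType (p (fromℕ m))

-- A vertex of odd degree 2k+1 in a difference-1 colouring has exactly k+1
-- blue and k red edges.  Removing a leaf-twig configuration at v deletes the
-- blue leaf edge vℓ and the red edge vb (the two leaf edges at the base b are
-- blue, so its third edge is red), hence the colouring of G restricts to a
-- difference-1 colouring of the reduced form H; and since leaves and twig
-- bases never carry skeleton edges, H contains every skeleton edge.  In H the
-- two skeleton edges at a twig-type vertex are blue (its edge to the base is
-- its one red edge), those at a triple-type vertex are red (its three leaf
-- edges are its blue ones), and those at a leaf-type vertex differ in colour.
-- So the colours alternate along the limb, whose first and last edges are blue
-- at twig-type ends and red at triple-type ends.

module Submission where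

open import Defs
open import Data.Nat using (ℕ; zero; suc; _+_; _%_; _≤_; _<_; z≤n; s≤s)
open import Data.Nat.Properties
  using (+-suc; +-identityʳ; +-comm; +-assoc; +-cancelʳ-≡; +-cancelʳ-≤;
         ≤-trans; ≤-reflexive; m≤n⇒m≤1+n; ≤∧≢⇒<; <⇒≱; n≮n;
         1+n≢n; suc-injective; module ≤-Reasoning)
open import Data.Fin using (Fin; zero; suc; fromℕ; inject₁; toℕ; _≟_)
open import Data.Fin.Properties using (fromℕ≢inject₁; toℕ-inject₁)
  renaming (suc-injective to Fin-suc-injective)
open import Data.Bool using (Bool; true; false; _∧_; not; if_then_else_)
open import Data.Bool.Properties
  using (∧-identityʳ; ∧-zeroʳ; ∧-conicalˡ; ∧-conicalʳ; not-involutive; not-¬; ¬-not)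
open import Data.List using (List; []; _∷_; length)
open import Data.List.Relation.Unary.All as All using (All; []; _∷_)
open import Data.List.Relation.Unary.All.Properties using (¬Any⇒All¬)
open import Data.List.Relation.Unary.Any using (here; there; any?)
open import Data.List.Relation.Unary.AllPairs using ([]; _∷_)
open import Data.List.Relation.Unary.Unique.Propositional using (Unique)
open import Data.List.Membership.Propositional using (_∈_)
open import Data.Product using (_×_; _,_; proj₁; proj₂)
open import Data.Sum using (_⊎_; inj₁; inj₂)
open import Data.Empty using (⊥)
open import Function using (_∘_; id; case_of_)
open import Relation.Nullary using (¬_; yes; no)
open import Relation.Nullary.Decidable using (dec-true; dec-false; isYes≗does)
open import Relation.Nullary.Negation using (contradiction)
open import Relation.Binary.PropositionalEquality
open import Relation.Binary.Construct.Closure.ReflexiveTransitive using (Star; fold)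

∧-intro : ∀ {x y} → x ≡ true → y ≡ true → x ∧ y ≡ true
∧-intro refl refl = refl

==-refl : ∀ {n} (x : Fin n) → (x == x) ≡ true
==-refl x = trans (isYes≗does (x ≟ x)) (dec-true (x ≟ x) refl)

≢⇒==-false : ∀ {n} {x y : Fin n} → x ≢ y → (x == y) ≡ false
≢⇒==-false {x = x} {y} x≢y = trans (isYes≗does (x ≟ y)) (dec-false (x ≟ y) x≢y)

not-==⇒≢ : ∀ {n} {x y : Fin n} → not (x == y) ≡ true → x ≢ y
not-==⇒≢ {x = x} ne refl = contradiction (trans (sym ne) (cong not (==-refl x))) λ ()

inject₁≢suc : ∀ {m} (i : Fin m) → inject₁ i ≢ suc i
inject₁≢suc i e = 1+n≢n (sym (trans (sym (toℕ-inject₁ i)) (cong toℕ e)))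

count-ext : ∀ {n} {p q : Fin n → Bool} → (∀ u → p u ≡ q u) → count p ≡ count q
count-ext {zero}  _  = refl
count-ext {suc n} eq =
  cong₂ _+_ (cong (λ b → if b then 1 else 0) (eq zero)) (count-ext (eq ∘ suc))

count-none : ∀ {n} {p : Fin n → Bool} → (∀ u → p u ≡ false) → count p ≡ 0
count-none {zero}  _ = refl
count-none {suc n} none rewrite none zero = count-none (none ∘ suc)

count-except : ∀ {n} {p q : Fin n → Bool} {a} → p a ≡ true → q a ≡ false →
               (∀ u → u ≢ a → p u ≡ q u) → count p ≡ suc (count q)
count-except {suc n} {a = zero} pa qa agree rewrite pa | qa =
  cong suc (count-ext (λ u → agree (suc u) λ ()))
count-except {suc n} {a = suc a} pa qa agree rewrite agree zero (λ ()) =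
  trans (cong (_ +_) (count-except pa qa (λ u u≢a → agree (suc u) (u≢a ∘ Fin-suc-injective))))
        (+-suc _ _)

count-unique : ∀ {n} {p : Fin n → Bool} {a} → p a ≡ true → (∀ u → p u ≡ true → u ≡ a) →
               count p ≡ 1
count-unique {n} {p} pa only =
  trans (count-except {q = λ _ → false} pa refl (λ u u≢a → ¬-not (u≢a ∘ only u)))
        (cong suc (count-none {n} (λ _ → refl)))

count-split : ∀ {n} (p f : Fin n → Bool) →
              count p ≡ count (λ u → p u ∧ f u) + count (λ u → p u ∧ not (f u))
count-split {zero}  p f = refl
count-split {suc n} p f with p zero | f zero
... | false | _     = count-split (p ∘ suc) (f ∘ suc)
... | true  | true  = cong suc (count-split (p ∘ suc) (f ∘ suc))
... | true  | false = trans (cong suc (count-split (p ∘ suc) (f ∘ suc))) (sym (+-suc _ _))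

count-mono : ∀ {n} {p q : Fin n → Bool} → (∀ u → p u ≡ true → q u ≡ true) → count p ≤ count q
count-mono {zero} _ = z≤n
count-mono {suc n} {p} {q} p⇒q with p zero in pz | q zero in qz
... | false | false = count-mono (p⇒q ∘ suc)
... | false | true  = m≤n⇒m≤1+n (count-mono (p⇒q ∘ suc))
... | true  | true  = s≤s (count-mono (p⇒q ∘ suc))
... | true  | false = contradiction (trans (sym (p⇒q zero pz)) qz) λ ()

count-mono-+ : ∀ {n} {p q : Fin n → Bool} {xs : List (Fin n)} →
               (∀ u → p u ≡ true → q u ≡ true) → Unique xs →
               All (λ x → q x ≡ true × p x ≡ false) xs → count p + length xs ≤ count q
count-mono-+ {xs = []} p⇒q [] [] = ≤-trans (≤-reflexive (+-identityʳ _)) (count-mono p⇒q)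
count-mono-+ {p = p} {q} {x ∷ xs} p⇒q (x∉xs ∷ xs-unique) ((qx , px) ∷ xs-ok) = begin
  count p + suc (length xs)  ≡⟨ +-suc (count p) (length xs) ⟩
  suc (count p + length xs)  ≤⟨ s≤s (count-mono-+ p⇒q-x xs-unique (All.zipWith ok-x (x∉xs , xs-ok))) ⟩
  suc (count q-x)            ≡⟨ count-except qx q-x-x (λ u u≢x → sym (q-x-off u u≢x)) ⟨
  count q                    ∎
  where
  open ≤-Reasoning
  q-x : Fin _ → Bool
  q-x u = q u ∧ not (u == x)
  q-x-x : q-x x ≡ false
  q-x-x = trans (cong (λ b → q x ∧ not b) (==-refl x)) (∧-zeroʳ (q x))
  q-x-off : ∀ u → u ≢ x → q-x u ≡ q u
  q-x-off u u≢x = trans (cong (λ b → q u ∧ not b) (≢⇒==-false u≢x)) (∧-identityʳ (q u))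
  p⇒q-x : ∀ u → p u ≡ true → q-x u ≡ true
  p⇒q-x u pu = trans (q-x-off u λ { refl → contradiction (trans (sym pu) px) λ () }) (p⇒q u pu)
  ok-x : ∀ {y} → x ≢ y × (q y ≡ true × p y ≡ false) → q-x y ≡ true × p y ≡ false
  ok-x (x≢y , qy , py) = trans (q-x-off _ (x≢y ∘ sym)) qy , py

length≤count : ∀ {n} {p : Fin n → Bool} {xs : List (Fin n)} →
               Unique xs → All (λ x → p x ≡ true) xs → length xs ≤ count p
length≤count {n} {p} {xs} xs-unique xs-ok =
  subst (_≤ count p) (cong (_+ length xs) (count-none {n} {λ _ → false} (λ _ → refl)))
        (count-mono-+ (λ _ ()) xs-unique (All.map (_, refl) xs-ok))

even⇒suc-odd : ∀ k → k % 2 ≡ 0 → suc k % 2 ≡ 1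
even⇒suc-odd zero          _ = refl
even⇒suc-odd (suc zero)    ()
even⇒suc-odd (suc (suc k)) e = even⇒suc-odd k e

odd⇒suc-even : ∀ k → k % 2 ≡ 1 → suc k % 2 ≡ 0
odd⇒suc-even zero          ()
odd⇒suc-even (suc zero)    _ = refl
odd⇒suc-even (suc (suc k)) e = odd⇒suc-even k e

Alternating : ∀ {m} → (Fin (suc m) → Bool) → Set
Alternating {m} f = ∀ (i : Fin m) → f (inject₁ i) ≡ not (f (suc i))

alternating-ends : ∀ m {f : Fin (suc m) → Bool} → Alternating f →
                   (f (fromℕ m) ≡ f zero → suc m % 2 ≡ 1)
                 × (f (fromℕ m) ≡ not (f zero) → suc m % 2 ≡ 0)
alternating-ends zero    _ = (λ _ → refl) , (λ e → contradiction e (not-¬ refl))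
alternating-ends (suc m) {f} alt = same , opposite
  where
  init : (f (inject₁ (fromℕ m)) ≡ f zero → suc m % 2 ≡ 1)
       × (f (inject₁ (fromℕ m)) ≡ not (f zero) → suc m % 2 ≡ 0)
  init = alternating-ends m {f ∘ inject₁} (alt ∘ inject₁)
  last : not (f (fromℕ (suc m))) ≡ f (inject₁ (fromℕ m))
  last = sym (alt (fromℕ m))
  same : f (fromℕ (suc m)) ≡ f zero → suc (suc m) % 2 ≡ 1
  same e = even⇒suc-odd (suc m) (proj₂ init (trans (sym last) (cong not e)))
  opposite : f (fromℕ (suc m)) ≡ not (f zero) → suc (suc m) % 2 ≡ 0
  opposite e = odd⇒suc-even (suc m)
    (proj₁ init (trans (sym last) (trans (cong not e) (not-involutive (f zero)))))

module _ {n : ℕ} (G : Graph n) where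

  nbr : VSet n → Fin n → Fin n → Bool
  nbr S x u = S u ∧ adj G x u

  adj-flip : ∀ {x y} → adj G x y ≡ true → adj G y x ≡ true
  adj-flip {x} {y} = trans (adj-sym G y x)

  nbr-flip : ∀ {S x y} → S x ≡ true → nbr S x y ≡ true → nbr S y x ≡ true
  nbr-flip Sx xy = ∧-intro Sx (adj-flip (∧-conicalʳ _ _ xy))

  nbr⇒∈ : ∀ {S x y} {xs : List (Fin n)} → deg G S x ≡ length xs → Unique xs →
          All (λ u → nbr S x u ≡ true) xs → nbr S x y ≡ true → y ∈ xs
  nbr⇒∈ {y = y} {xs} deg-x xs-unique xs-nbr y-nbr with any? (y ≟_) xs
  ... | yes y∈xs = y∈xs
  ... | no  y∉xs = contradiction
    (subst (suc (length xs) ≤_) deg-x (length≤count (¬Any⇒All¬ xs y∉xs ∷ xs-unique) (y-nbr ∷ xs-nbr)))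
    (n≮n (length xs))

  ≢leaf : ∀ {S x l} → deg G S x ≡ 3 → Leaf G S l → x ≢ l
  ≢leaf deg-x (_ , deg-l) refl = contradiction (trans (sym deg-x) deg-l) λ ()

  Twig : VSet n → (b l₁ l₂ : Fin n) → Set
  Twig S b l₁ l₂ = S b ≡ true × deg G S b ≡ 3 × l₁ ≢ l₂ ×
    adj G b l₁ ≡ true × adj G b l₂ ≡ true × Leaf G S l₁ × Leaf G S l₂

  CoversSkeleton : VSet n → VSet n → Set
  CoversSkeleton K S = ∀ w u → K w ≡ true → K u ≡ true → adj G w u ≡ true → S w ≡ true

  skeletonNbr⇒nbr : ∀ {K S x u} → CoversSkeleton K S → K x ≡ true →
                    nbr K x u ≡ true → nbr S x u ≡ true
  skeletonNbr⇒nbr {K} {x = x} {u} covers Kx u-nbr =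
    ∧-intro (covers u x (∧-conicalˡ (K u) _ u-nbr) Kx (adj-flip (∧-conicalʳ (K u) _ u-nbr)))
            (∧-conicalʳ (K u) _ u-nbr)

kept : ∀ {n} (ℓ b l₁ l₂ : Fin n) → VSet n
kept ℓ b l₁ l₂ u = not (u == ℓ) ∧ not (u == b) ∧ not (u == l₁) ∧ not (u == l₂)

Removed : ∀ {n} (ℓ b l₁ l₂ u : Fin n) → Set
Removed ℓ b l₁ l₂ u = u ≡ ℓ ⊎ u ≡ b ⊎ u ≡ l₁ ⊎ u ≡ l₂

module _ {n : ℕ} {ℓ b l₁ l₂ : Fin n} where

  kept⇒¬removed : ∀ {u} → kept ℓ b l₁ l₂ u ≡ true → ¬ Removed ℓ b l₁ l₂ u
  kept⇒¬removed {u} k r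
    with not-==⇒≢ (∧-conicalˡ (not (u == ℓ)) _ k) | ∧-conicalʳ (not (u == ℓ)) _ k
  ... | u≢ℓ | k₂
    with not-==⇒≢ (∧-conicalˡ (not (u == b)) _ k₂) | ∧-conicalʳ (not (u == b)) _ k₂
  ... | u≢b | k₃
    with not-==⇒≢ (∧-conicalˡ (not (u == l₁)) _ k₃) | not-==⇒≢ (∧-conicalʳ (not (u == l₁)) _ k₃)
  ... | u≢l₁ | u≢l₂ = case r of λ
    { (inj₁ u≡ℓ)                → u≢ℓ u≡ℓ
    ; (inj₂ (inj₁ u≡b))         → u≢b u≡b
    ; (inj₂ (inj₂ (inj₁ u≡l₁))) → u≢l₁ u≡l₁
    ; (inj₂ (inj₂ (inj₂ u≡l₂))) → u≢l₂ u≡l₂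
    }

  ¬kept⇒removed : ∀ {u} → kept ℓ b l₁ l₂ u ≡ false → Removed ℓ b l₁ l₂ u
  ¬kept⇒removed {u} ¬k with u ≟ ℓ | u ≟ b | u ≟ l₁ | u ≟ l₂
  ... | yes e | _     | _     | _     = inj₁ e
  ... | no _  | yes e | _     | _     = inj₂ (inj₁ e)
  ... | no _  | no _  | yes e | _     = inj₂ (inj₂ (inj₁ e))
  ... | no _  | no _  | no _  | yes e = inj₂ (inj₂ (inj₂ e))
  ... | no _  | no _  | no _  | no _  = contradiction ¬k λ ()

  removed⇒¬kept : ∀ u → Removed ℓ b l₁ l₂ u → kept ℓ b l₁ l₂ u ≡ false
  removed⇒¬kept _ r = ¬-not (λ k → kept⇒¬removed k r)

  ¬removed⇒kept : ∀ u → ¬ Removed ℓ b l₁ l₂ u → kept ℓ b l₁ l₂ u ≡ true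
  ¬removed⇒kept _ ¬r = ¬-not (¬r ∘ ¬kept⇒removed)

-- Difference-1 colourings of induced subgraphs

double-injective : ∀ {m k} → m + m ≡ k + k → m ≡ k
double-injective {zero}  {zero}  _ = refl
double-injective {suc m} {suc k} e rewrite +-suc m m | +-suc k k =
  cong suc (double-injective (suc-injective (suc-injective e)))

module _ {n : ℕ} {G : Graph n} (c : Colouring G) where

  blueNbr redNbr : VSet n → Fin n → Fin n → Bool
  blueNbr S x u = nbr G S x u ∧ col c x u
  redNbr  S x u = nbr G S x u ∧ not (col c x u)

  blue red : VSet n → Fin n → ℕ
  blue S x = count (blueNbr S x)
  red  S x = count (redNbr S x)

  Diff1On : VSet n → Set
  Diff1On S = ∀ x → S x ≡ true → blue S x ≡ red S x + 1

  diff1-odd : ∀ {S x} k → Diff1On S → S x ≡ true → deg G S x ≡ suc (k + k) →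
              red S x ≡ k × blue S x ≡ suc k
  diff1-odd {S} {x} k d1 Sx deg-x = red≡k , trans (d1 x Sx) (trans (+-comm _ 1) (cong suc red≡k))
    where
    red≡k : red S x ≡ k
    red≡k = double-injective (suc-injective (begin
      suc (red S x + red S x)   ≡⟨ cong (_+ red S x) (trans (+-comm 1 _) (sym (d1 x Sx))) ⟩
      blue S x + red S x        ≡⟨ count-split (nbr G S x) (col c x) ⟨
      deg G S x                 ≡⟨ deg-x ⟩
      suc (k + k)               ∎))
      where open ≡-Reasoning

  forced-red : ∀ {S x y} {xs : List (Fin n)} → blue S x ≡ length xs → Unique xs →
               All (λ u → blueNbr S x u ≡ true) xs → nbr G S x y ≡ true → All (y ≢_) xs →
               col c x y ≡ false
  forced-red {xs = xs} blue-x xs-unique xs-blue y-nbr y∉xs = ¬-not λ y-blue →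
    n≮n (length xs) (subst (suc (length xs) ≤_) blue-x
      (length≤count (y∉xs ∷ xs-unique) (∧-intro y-nbr y-blue ∷ xs-blue)))

  forced-blue : ∀ {S x y} {xs : List (Fin n)} → red S x ≡ length xs → Unique xs →
                All (λ u → redNbr S x u ≡ true) xs → nbr G S x y ≡ true → All (y ≢_) xs →
                col c x y ≡ true
  forced-blue {xs = xs} red-x xs-unique xs-red y-nbr y∉xs = ¬-not λ y-red →
    n≮n (length xs) (subst (suc (length xs) ≤_) red-x
      (length≤count (y∉xs ∷ xs-unique) (∧-intro y-nbr (cong not y-red) ∷ xs-red)))

  leafEdge-blue : ∀ {S z y} → Diff1On S → Leaf G S z → nbr G S z y ≡ true → col c z y ≡ true
  leafEdge-blue d1 (Sz , deg-z) y-nbr = forced-blue (proj₁ (diff1-odd 0 d1 Sz deg-z)) [] [] y-nbr []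

  leaf-blueNbr : ∀ {S x z} → Diff1On S → Leaf G S z → S x ≡ true → adj G x z ≡ true →
                 blueNbr S x z ≡ true
  leaf-blueNbr d1 leaf Sx a =
    ∧-intro (∧-intro (proj₁ leaf) a)
            (trans (col-sym c _ _) (leafEdge-blue d1 leaf (∧-intro Sx (adj-flip G a))))

  twigEdge-red : ∀ {S b l₁ l₂ x} → Diff1On S → Twig G S b l₁ l₂ → nbr G S b x ≡ true →
                 x ≢ l₁ → x ≢ l₂ → col c b x ≡ false
  twigEdge-red d1 (Sb , deg-b , l₁≢l₂ , a₁ , a₂ , leaf₁ , leaf₂) x-nbr x≢l₁ x≢l₂ =
    forced-red (proj₂ (diff1-odd 1 d1 Sb deg-b)) ((l₁≢l₂ ∷ []) ∷ [] ∷ [])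
      (leaf-blueNbr d1 leaf₁ Sb a₁ ∷ leaf-blueNbr d1 leaf₂ Sb a₂ ∷ []) x-nbr (x≢l₁ ∷ x≢l₂ ∷ [])

-- Leaves and twig bases stay off the skeleton

module _ {n : ℕ} {G : Graph n} {K : VSet n} (K-leafless : ∀ x → ¬ Leaf G K x) where

  1<skeletonDeg : ∀ {x u} → K x ≡ true → nbr G K x u ≡ true → 1 < deg G K x
  1<skeletonDeg {x} Kx u-nbr =
    ≤∧≢⇒< (length≤count {p = nbr G K x} ([] ∷ []) (u-nbr ∷ []))
          (λ deg≡1 → K-leafless x (Kx , sym deg≡1))

  leaf-∉skeleton : ∀ {S z u} → CoversSkeleton G K S → Leaf G S z → K z ≡ true →
                   nbr G K z u ≡ true → ⊥
  leaf-∉skeleton {S} {z} covers (_ , deg-z) Kz u-nbr =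
    <⇒≱ (1<skeletonDeg Kz u-nbr)
        (≤-trans (count-mono {p = nbr G K z} {nbr G S z} (λ _ → skeletonNbr⇒nbr G covers Kz))
                 (≤-reflexive deg-z))

  twigBase-∉skeleton : ∀ {S b l₁ l₂ u} → CoversSkeleton G K S → Twig G S b l₁ l₂ → K b ≡ true →
                       nbr G K b u ≡ true → ⊥
  twigBase-∉skeleton {S} {b} covers (_ , deg-b , l₁≢l₂ , a₁ , a₂ , leaf₁ , leaf₂) Kb u-nbr =
    <⇒≱ (1<skeletonDeg Kb u-nbr) (+-cancelʳ-≤ 2 _ 1 (≤-trans
      (count-mono-+ {p = nbr G K b} {nbr G S b} (λ _ → skeletonNbr⇒nbr G covers Kb)
                    ((l₁≢l₂ ∷ []) ∷ [] ∷ []) (leafNbr leaf₁ a₁ ∷ leafNbr leaf₂ a₂ ∷ []))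
      (≤-reflexive deg-b)))
    where
    leafNbr : ∀ {l} → Leaf G S l → adj G b l ≡ true → nbr G S b l ≡ true × nbr G K b l ≡ false
    leafNbr leaf a = ∧-intro (proj₁ leaf) a ,
      ¬-not (λ l-nbr → leaf-∉skeleton covers leaf (∧-conicalˡ _ _ l-nbr) (∧-intro Kb (adj-flip G a)))

  covers-step : ∀ {S S'} → CoversSkeleton G K S → LTStep G S S' → CoversSkeleton G K S'
  covers-step covers (v , ℓ , b , l₁ , l₂ , (_ , _ , _ , _ , _ , _ , _ , _ , _ , _ , l₁≢l₂ ,
                      leaf-ℓ , _ , _ , Sb , deg-b , a₁ , a₂ , leaf₁ , leaf₂) , S'≡) w u Kw Ku a =
    trans (S'≡ w) (∧-intro (covers w u Kw Ku a) (¬removed⇒kept w λ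
      { (inj₁ refl)               → leaf-∉skeleton covers leaf-ℓ Kw u-nbr
      ; (inj₂ (inj₁ refl))        →
          twigBase-∉skeleton covers (Sb , deg-b , l₁≢l₂ , a₁ , a₂ , leaf₁ , leaf₂) Kw u-nbr
      ; (inj₂ (inj₂ (inj₁ refl))) → leaf-∉skeleton covers leaf₁ Kw u-nbr
      ; (inj₂ (inj₂ (inj₂ refl))) → leaf-∉skeleton covers leaf₂ Kw u-nbr
      }))
    where
    u-nbr : nbr G K w u ≡ true
    u-nbr = ∧-intro Ku a

-- A leaf-twig removal preserves difference-1 colourings

diff1-cancel : ∀ {B R B' R' e} → B ≡ B' + e → R ≡ R' + e → B ≡ R + 1 → B' ≡ R' + 1
diff1-cancel {B} {R} {B'} {R'} {e} B≡ R≡ B≡R+1 = +-cancelʳ-≡ e B' (R' + 1) (begin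
  B' + e        ≡⟨ B≡ ⟨
  B             ≡⟨ B≡R+1 ⟩
  R + 1         ≡⟨ cong (_+ 1) R≡ ⟩
  R' + e + 1    ≡⟨ +-assoc R' e 1 ⟩
  R' + (e + 1)  ≡⟨ cong (R' +_) (+-comm e 1) ⟩
  R' + (1 + e)  ≡⟨ +-assoc R' 1 e ⟨
  R' + 1 + e    ∎)
  where open ≡-Reasoning

∧-pull : ∀ s k a q → ((s ∧ k) ∧ a) ∧ q ≡ ((s ∧ a) ∧ q) ∧ k
∧-pull false _     _ _ = refl
∧-pull true  true  _ _ = sym (∧-identityʳ _)
∧-pull true  false _ _ = sym (∧-zeroʳ _)

module LeafTwigRemoval
  {n : ℕ} {G : Graph n} (c : Colouring G) {S S' : VSet n} {v ℓ b l₁ l₂ : Fin n}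
  (d1 : Diff1On c S) (Sv : S v ≡ true)
  (v≢l₁ : v ≢ l₁) (v≢l₂ : v ≢ l₂) (l₁≢l₂ : l₁ ≢ l₂)
  (leaf-ℓ : Leaf G S ℓ) (avℓ : adj G v ℓ ≡ true) (avb : adj G v b ≡ true)
  (Sb : S b ≡ true) (deg-b : deg G S b ≡ 3) (ab₁ : adj G b l₁ ≡ true) (ab₂ : adj G b l₂ ≡ true)
  (leaf₁ : Leaf G S l₁) (leaf₂ : Leaf G S l₂)
  (S'≡ : ∀ u → S' u ≡ S u ∧ kept ℓ b l₁ l₂ u)
  where

  private
    keep : VSet n
    keep = kept ℓ b l₁ l₂

    vℓ-blue : blueNbr c S v ℓ ≡ true
    vℓ-blue = leaf-blueNbr c d1 leaf-ℓ Sv avℓ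

    vb-red : col c v b ≡ false
    vb-red = trans (col-sym c v b)
      (twigEdge-red c d1 (Sb , deg-b , l₁≢l₂ , ab₁ , ab₂ , leaf₁ , leaf₂)
                    (∧-intro Sv (adj-flip G avb)) v≢l₁ v≢l₂)

    survivor : ∀ {w} → S' w ≡ true → S w ≡ true × keep w ≡ true
    survivor {w} S'w = ∧-conicalˡ (S w) (keep w) S∧keep , ∧-conicalʳ (S w) (keep w) S∧keep
      where
      S∧keep : S w ∧ keep w ≡ true
      S∧keep = trans (sym (S'≡ w)) S'w

    removed-nbr : ∀ {w r} → S w ≡ true → keep w ≡ true → Removed ℓ b l₁ l₂ r →
                  nbr G S w r ≡ true → w ≡ v × (r ≡ ℓ ⊎ r ≡ b)
    removed-nbr Sw _ (inj₁ refl) r-nbr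
      with nbr⇒∈ G (proj₂ leaf-ℓ) ([] ∷ []) (∧-intro Sv (adj-flip G avℓ) ∷ []) (nbr-flip G Sw r-nbr)
    ... | here w≡v = w≡v , inj₁ refl
    removed-nbr Sw kw (inj₂ (inj₁ refl)) r-nbr
      with nbr⇒∈ G deg-b ((v≢l₁ ∷ v≢l₂ ∷ []) ∷ (l₁≢l₂ ∷ []) ∷ [] ∷ [])
             (∧-intro Sv (adj-flip G avb) ∷ ∧-intro (proj₁ leaf₁) ab₁ ∷ ∧-intro (proj₁ leaf₂) ab₂ ∷ [])
             (nbr-flip G Sw r-nbr)
    ... | here w≡v                  = w≡v , inj₂ refl
    ... | there (here w≡l₁)         = contradiction (inj₂ (inj₂ (inj₁ w≡l₁))) (kept⇒¬removed kw)
    ... | there (there (here w≡l₂)) = contradiction (inj₂ (inj₂ (inj₂ w≡l₂))) (kept⇒¬removed kw)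
    removed-nbr Sw kw (inj₂ (inj₂ (inj₁ refl))) r-nbr
      with nbr⇒∈ G (proj₂ leaf₁) ([] ∷ []) (∧-intro Sb (adj-flip G ab₁) ∷ []) (nbr-flip G Sw r-nbr)
    ... | here w≡b = contradiction (inj₂ (inj₁ w≡b)) (kept⇒¬removed kw)
    removed-nbr Sw kw (inj₂ (inj₂ (inj₂ refl))) r-nbr
      with nbr⇒∈ G (proj₂ leaf₂) ([] ∷ []) (∧-intro Sb (adj-flip G ab₂) ∷ []) (nbr-flip G Sw r-nbr)
    ... | here w≡b = contradiction (inj₂ (inj₁ w≡b)) (kept⇒¬removed kw)

    removedEdges : (Fin n → Bool) → Fin n → ℕ
    removedEdges Q w = count (λ u → (nbr G S w u ∧ Q u) ∧ not (keep u))

    removedEdge : ∀ (Q : Fin n → Bool) {w u} → S' w ≡ true →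
                  (nbr G S w u ∧ Q u) ∧ not (keep u) ≡ true → w ≡ v × (u ≡ ℓ ⊎ u ≡ b)
    removedEdge Q {w} {u} S'w e =
      removed-nbr (proj₁ (survivor S'w)) (proj₂ (survivor S'w))
        (¬kept⇒removed (trans (sym (not-involutive (keep u)))
                              (cong not (∧-conicalʳ _ (not (keep u)) e))))
        (∧-conicalˡ (nbr G S w u) (Q u) (∧-conicalˡ _ (not (keep u)) e))

    count-removal : ∀ Q w → count (λ u → nbr G S w u ∧ Q u)
                          ≡ count (λ u → nbr G S' w u ∧ Q u) + removedEdges Q w
    count-removal Q w = trans (count-split _ keep) (cong (_+ removedEdges Q w) (count-ext λ u →
      sym (trans (cong (λ s → (s ∧ adj G w u) ∧ Q u) (S'≡ u))
                 (∧-pull (S u) (keep u) (adj G w u) (Q u)))))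

    -- Each survivor loses as many blue as red edges: none, or vℓ and vb at v.
    removedEdges-balanced : ∀ {w} → S' w ≡ true →
                            removedEdges (col c w) w ≡ removedEdges (not ∘ col c w) w
    removedEdges-balanced {w} S'w with w ≟ v
    ... | no w≢v = trans (count-none (none (col c w))) (sym (count-none (none (not ∘ col c w))))
      where
      none : ∀ (Q : Fin n → Bool) u → (nbr G S w u ∧ Q u) ∧ not (keep u) ≡ false
      none Q u = ¬-not (w≢v ∘ proj₁ ∘ removedEdge Q S'w)
    ... | yes refl = trans
      (count-unique (∧-intro vℓ-blue (cong not (removed⇒¬kept ℓ (inj₁ refl)))) only-ℓ)
      (sym (count-unique (∧-intro (∧-intro (∧-intro Sb avb) (cong not vb-red))
                                  (cong not (removed⇒¬kept b (inj₂ (inj₁ refl))))) only-b))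
      where
      only-ℓ : ∀ u → blueNbr c S v u ∧ not (keep u) ≡ true → u ≡ ℓ
      only-ℓ u e with removedEdge (col c v) S'w e
      ... | _ , inj₁ u≡ℓ  = u≡ℓ
      ... | _ , inj₂ refl = contradiction
        (trans (sym (∧-conicalʳ (nbr G S v b) _ (∧-conicalˡ (blueNbr c S v b) _ e))) vb-red) λ ()
      only-b : ∀ u → redNbr c S v u ∧ not (keep u) ≡ true → u ≡ b
      only-b u e with removedEdge (not ∘ col c v) S'w e
      ... | _ , inj₂ u≡b  = u≡b
      ... | _ , inj₁ refl = contradiction
        (trans (sym (∧-conicalʳ (nbr G S v ℓ) _ (∧-conicalˡ (redNbr c S v ℓ) _ e)))
               (cong not (∧-conicalʳ (nbr G S v ℓ) _ vℓ-blue))) λ ()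

  diff1-S' : Diff1On c S'
  diff1-S' w S'w = diff1-cancel (count-removal (col c w) w)
    (trans (count-removal (not ∘ col c w) w)
           (cong (red c S' w +_) (sym (removedEdges-balanced S'w))))
    (d1 w (proj₁ (survivor S'w)))

diff1-step : ∀ {n} {G : Graph n} (c : Colouring G) {S S'} →
             Diff1On c S → LTStep G S S' → Diff1On c S'
diff1-step c d1 (_ , _ , _ , _ , _ , (Sv , _ , _ , v≢l₁ , v≢l₂ , _ , _ , _ , _ , _ , l₁≢l₂ ,
                 leaf-ℓ , avℓ , avb , Sb , deg-b , ab₁ , ab₂ , leaf₁ , leaf₂) , S'≡) =
  LeafTwigRemoval.diff1-S' c d1 Sv v≢l₁ v≢l₂ l₁≢l₂ leaf-ℓ avℓ avb Sb deg-b ab₁ ab₂ leaf₁ leaf₂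
                           S'≡

preserved-along : ∀ {a r} {A : Set a} {R : A → A → Set r} (P : A → Set) →
                  (∀ {x y} → P x → R x y → P y) → ∀ {x y} → Star R x y → P x → P y
preserved-along P step = fold (λ x y → P x → P y) (λ r k px → k (step px r)) id

-- Skeleton edges at the vertex types of a limb

module _ {n : ℕ} {G : Graph n} {K H : VSet n} (c : Colouring G) (K-leafless : ∀ x → ¬ Leaf G K x)
         (covers : CoversSkeleton G K H) (d1 : Diff1On c H) where

  skeletonNbr≢leaf : ∀ {x y l} → K x ≡ true → nbr G K x y ≡ true → Leaf G H l → y ≢ l
  skeletonNbr≢leaf {x} {y} Kx y-nbr leaf refl =
    leaf-∉skeleton {G = G} {K} K-leafless covers leaf (∧-conicalˡ (K y) _ y-nbr)
                   (nbr-flip G Kx y-nbr)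

  twigType-edge-blue : ∀ {x y} → TwigType G K H x → nbr G K x y ≡ true → col c x y ≡ true
  twigType-edge-blue {x} {y} ((Kx , _) , Hx , deg-x , b , axb ,
                              Hb , deg-b , l₁ , l₂ , l₁≢l₂ , ab₁ , ab₂ , leaf₁ , leaf₂) y-nbr =
    forced-blue c (proj₁ (diff1-odd c 1 d1 Hx deg-x)) ([] ∷ [])
      (∧-intro (∧-intro Hb axb) (cong not xb-red) ∷ [])
      (skeletonNbr⇒nbr G covers Kx y-nbr) (y≢b ∷ [])
    where
    twig : Twig G H b l₁ l₂
    twig = Hb , deg-b , l₁≢l₂ , ab₁ , ab₂ , leaf₁ , leaf₂
    xb-red : col c x b ≡ false
    xb-red = trans (col-sym c x b) (twigEdge-red c d1 twig (∧-intro Hx (adj-flip G axb))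
                                      (≢leaf G deg-x leaf₁) (≢leaf G deg-x leaf₂))
    y≢b : y ≢ b
    y≢b refl = twigBase-∉skeleton {G = G} {K} K-leafless covers twig (∧-conicalˡ (K y) _ y-nbr)
                                  (nbr-flip G Kx y-nbr)

  tripleType-edge-red : ∀ {x y} → TripleType G K H x → nbr G K x y ≡ true → col c x y ≡ false
  tripleType-edge-red ((Kx , _) , Hx , deg-x , _ , _ , _ , d₁₂ , d₁₃ , d₂₃ , a₁ , a₂ , a₃ ,
                       leaf₁ , leaf₂ , leaf₃) y-nbr =
    forced-red c (proj₂ (diff1-odd c 2 d1 Hx deg-x)) ((d₁₂ ∷ d₁₃ ∷ []) ∷ (d₂₃ ∷ []) ∷ [] ∷ [])
      (leaf-blueNbr c d1 leaf₁ Hx a₁ ∷ leaf-blueNbr c d1 leaf₂ Hx a₂ ∷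
       leaf-blueNbr c d1 leaf₃ Hx a₃ ∷ [])
      (skeletonNbr⇒nbr G covers Kx y-nbr)
      (skeletonNbr≢leaf Kx y-nbr leaf₁ ∷ skeletonNbr≢leaf Kx y-nbr leaf₂ ∷
       skeletonNbr≢leaf Kx y-nbr leaf₃ ∷ [])

  leafType-edges-alternate : ∀ {x a a'} → LeafType G K H x →
                             nbr G K x a ≡ true → nbr G K x a' ≡ true → a ≢ a' →
                             col c x a ≡ not (col c x a')
  leafType-edges-alternate {x} {a} {a'} ((Kx , _) , Hx , deg-x , y , axy , leaf-y) a-nbr a'-nbr a≢a'
    with col c x a in xa
  ... | true = sym (cong not (forced-red c (proj₂ (diff1-odd c 1 d1 Hx deg-x))
      ((skeletonNbr≢leaf Kx a-nbr leaf-y ∘ sym ∷ []) ∷ [] ∷ [])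
      (leaf-blueNbr c d1 leaf-y Hx axy ∷ ∧-intro (skeletonNbr⇒nbr G covers Kx a-nbr) xa ∷ [])
      (skeletonNbr⇒nbr G covers Kx a'-nbr) (skeletonNbr≢leaf Kx a'-nbr leaf-y ∷ (a≢a' ∘ sym) ∷ [])))
  ... | false = sym (cong not (forced-blue c (proj₁ (diff1-odd c 1 d1 Hx deg-x)) ([] ∷ [])
      (∧-intro (skeletonNbr⇒nbr G covers Kx a-nbr) (cong not xa) ∷ [])
      (skeletonNbr⇒nbr G covers Kx a'-nbr) ((a≢a' ∘ sym) ∷ [])))

module Limb {n : ℕ} {G : Graph n} {K H : VSet n} (c : Colouring G) (K-leafless : ∀ x → ¬ Leaf G K x)
            (covers : CoversSkeleton G K H) (d1 : Diff1On c H)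
            {m : ℕ} {p : Fin (suc (suc m)) → Fin n} (limb : IsLimb G K H (suc m) p) where

  edgeColour : Fin (suc m) → Bool
  edgeColour i = col c (p (inject₁ i)) (p (suc i))

  private
    edge : ∀ i → K (p (inject₁ i)) ≡ true × K (p (suc i)) ≡ true
               × adj G (p (inject₁ i)) (p (suc i)) ≡ true
    edge = proj₁ (proj₂ limb)

    inner : ∀ i → i ≢ zero → i ≢ fromℕ (suc m) → LeafType G K H (p i)
    inner = proj₁ (proj₂ (proj₂ (proj₂ limb)))

    forward : ∀ i → nbr G K (p (inject₁ i)) (p (suc i)) ≡ true
    forward i = let (_ , K₁ , a) = edge i in ∧-intro K₁ a

    backward : ∀ i → nbr G K (p (suc i)) (p (inject₁ i)) ≡ true
    backward i = let (K₀ , _ , a) = edge i in ∧-intro K₀ (adj-flip G a)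

    edgeColour-alternating : Alternating edgeColour
    edgeColour-alternating i = trans (col-sym c _ _)
      (leafType-edges-alternate c K-leafless covers d1 (inner (suc (inject₁ i)) (λ ()) interior)
                                (backward (inject₁ i)) (forward (suc i)) distinct)
      where
      interior : suc (inject₁ i) ≢ fromℕ (suc m)
      interior e = fromℕ≢inject₁ (sym (Fin-suc-injective e))
      distinct : p (inject₁ (inject₁ i)) ≢ p (suc (suc i))
      distinct e = proj₂ (proj₁ (proj₂ (proj₂ limb)) (inject₁ i) (suc i) (inject₁≢suc i)) (e , refl)

  sameEnds⇒odd : edgeColour (fromℕ m) ≡ edgeColour zero → suc m % 2 ≡ 1
  sameEnds⇒odd = proj₁ (alternating-ends m {edgeColour} edgeColour-alternating)

  oppositeEnds⇒even : edgeColour (fromℕ m) ≡ not (edgeColour zero) → suc m % 2 ≡ 0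
  oppositeEnds⇒even = proj₂ (alternating-ends m {edgeColour} edgeColour-alternating)

  first-twig : TwigType G K H (p zero) → edgeColour zero ≡ true
  first-twig twig = twigType-edge-blue c K-leafless covers d1 twig (forward zero)

  first-triple : TripleType G K H (p zero) → edgeColour zero ≡ false
  first-triple triple = tripleType-edge-red c K-leafless covers d1 triple (forward zero)

  last-twig : TwigType G K H (p (fromℕ (suc m))) → edgeColour (fromℕ m) ≡ true
  last-twig twig =
    trans (col-sym c _ _) (twigType-edge-blue c K-leafless covers d1 twig (backward (fromℕ m)))

  last-triple : TripleType G K H (p (fromℕ (suc m))) → edgeColour (fromℕ m) ≡ false
  last-triple triple =
    trans (col-sym c _ _) (tripleType-edge-red c K-leafless covers d1 triple (backward (fromℕ m)))

mainTheorem15 : ∀ {n} (G : Graph n) → HasCycle G → HasDiff1Colouring G →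
    (K H : VSet n) → IsSkeleton G K → IsReducedForm G H →
    (m : ℕ) (p : Fin (suc m) → Fin n) → IsLimb G K H m p →
    (TwigType G K H (p zero) ⊎ TripleType G K H (p zero)) →
    (TwigType G K H (p (fromℕ m)) ⊎ TripleType G K H (p (fromℕ m))) →
      (((TwigType G K H (p zero) × TwigType G K H (p (fromℕ m)))
        ⊎ (TripleType G K H (p zero) × TripleType G K H (p (fromℕ m))))
          → m % 2 ≡ 1)
    × (((TwigType G K H (p zero) × TripleType G K H (p (fromℕ m)))
        ⊎ (TripleType G K H (p zero) × TwigType G K H (p (fromℕ m))))
          → m % 2 ≡ 0)
mainTheorem15 G _ _ K H _ _ zero p (() , _) _ _
mainTheorem15 G _ (c , diff1) K H (_ , K-leafless) (reduction , _) (suc m) p limb _ _ =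
  (λ { (inj₁ (twig₀ , twigₘ)) →
          sameEnds⇒odd (trans (last-twig twigₘ) (sym (first-twig twig₀)))
      ; (inj₂ (triple₀ , tripleₘ)) →
          sameEnds⇒odd (trans (last-triple tripleₘ) (sym (first-triple triple₀))) }) ,
  (λ { (inj₁ (twig₀ , tripleₘ)) →
          oppositeEnds⇒even (trans (last-triple tripleₘ) (sym (cong not (first-twig twig₀))))
      ; (inj₂ (triple₀ , twigₘ)) →
          oppositeEnds⇒even (trans (last-twig twigₘ) (sym (cong not (first-triple triple₀)))) })
  where
  covers : CoversSkeleton G K H
  covers = preserved-along (CoversSkeleton G K) (covers-step {G = G} K-leafless) reduction
                           (λ _ _ _ _ _ → refl)
  d1 : Diff1On c H
  d1 = preserved-along (Diff1On c) (diff1-step c) reduction (λ x _ → diff1 x)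
  open Limb c K-leafless covers d1 limb
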